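{- For any prime $p>3$, we have $\mathbf{A}_p(\mathbb{F}_p)_{S(2)^*}=\{0\}$; that is, the only function $\mathbf{a}:\mathbb{F}_p\times\mathbb{F}_p\to\mathbb{F}_p$ satisfying $\mathbf{a}_{(i+1,j)}+\mathbf{a}_{(i,j+1)}+\mathbf{a}_{(i+1,j+1)}=0$ for all $(i,j)\in\mathbb{F}_p\times\mathbb{F}_p$ is the zero function.
   Context: For a prime $p$, $T_p=\mathbb{F}_p\times\mathbb{F}_p$ and $\mathbf{A}_p(\mathbb{F}_p)$ is the set of functions $T_p\to\mathbb{F}_p$ (equivalently, $\mathbb{F}_p$-valued arrays on $\mathbb{Z}^2$ with periods $(p,0)$ and $(0,p)$). For an integer $n\ge 2$, $S(n)^*=\{(i_1,i_2)\in\mathbb{Z}^2;0\le i_1,i_2\le n-1\}\setminus\{(0,0)\}$, and $\mathbf{A}_p(\mathbb{F}_p)_{S(n)^*}$ is the set of $\mathbf{a}\in\mathbf{A}_p(\mathbb{F}_p)$ with $\sum_{\mathbf{i}\in S(n)^*}\mathbf{a}_{\mathbf{i}+\mathbf{k}}=0$ for every $\mathbf{k}$ (indices taken modulo $p$). -}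

module Defs where

open import Data.Nat using (ℕ; suc; _+_; NonZero)
open import Data.Nat.DivMod using (_mod_)
open import Data.Fin using (Fin; toℕ; zero)
open import Relation.Binary.PropositionalEquality using (_≡_)

-- 𝔽_p is modelled as ℤ/pℤ with carrier Fin p (canonical representatives
-- 0..p-1); addition is addition of representatives reduced mod p.
𝔽 : (p : ℕ) → Set
𝔽 p = Fin p

module _ (p : ℕ) .{{_ : NonZero p}} where

  _⊕_ : 𝔽 p → 𝔽 p → 𝔽 p
  x ⊕ y = (toℕ x + toℕ y) mod p

  one : 𝔽 p
  one = 1 mod p

  Array : Set
  Array = 𝔽 p → 𝔽 p → 𝔽 p

  InS2* : Array → Set
  InS2* a = ∀ (i j : 𝔽 p) →
    (a (i ⊕ one) j ⊕ a i (j ⊕ one)) ⊕ a (i ⊕ one) (j ⊕ one) ≡ zero′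
    where
      zero′ : 𝔽 p
      zero′ = 0 mod p

  IsZero : Array → Set
  IsZero a = ∀ (i j : 𝔽 p) → a i j ≡ 0 mod p

-- Let X and Y shift an array along the two axes.  The relation defining
-- A_p(𝔽_p)_{S(2)^*} says (X + Y + XY) a = 0, i.e. (1 + X)(1 + Y) a = a, so also
-- (1 + X)ᵖ(1 + Y)ᵖ a = a.  In characteristic p, (1 + X)ᵖ = 1 + Xᵖ, and Xᵖ = Yᵖ = 1
-- on p-periodic arrays; hence 4a = a, so 3a = 0 and a = 0 because p > 3.
module Submission where

open import Defs
open import Data.Nat
  using (ℕ; _<_; NonZero; zero; suc; pred; _+_; _*_; _∸_; _%_; _!; z≤n; s≤s; nonTrivial⇒≢1)
open import Data.Nat.Primality using (Prime; euclidsLemma; prime⇒nonTrivial)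
open import Data.Nat.Properties
open import Data.Nat.Combinatorics
  using (_C_; nCk+nC[k+1]≡[n+1]C[k+1]; k>n⇒nCk≡0; nCn≡1; nCk≡n!/k![n-k]!; k![n∸k]!∣n!)
open import Data.Nat.DivMod
  using ( _mod_; %-distribˡ-+; %-distribˡ-*; %-remove-+ʳ; m%n%n≡m%n; [m+n]%n≡m%n
        ; m%n<n; m<n⇒m%n≡m; m/n*n≡m)
open import Data.Nat.Divisibility
  using (_∣_; _∣0; ∣m∣n⇒∣m+n; ∣m⇒∣m*n; m∣m*n; m%n≡0⇒n∣m; n∣m⇒m%n≡0; ∣⇒≤; ∣1⇒≡1)
open import Data.Product using (_×_; _,_)
open import Data.Sum using (inj₁; inj₂)
open import Relation.Nullary using (¬_; contradiction)
open import Data.Fin using (toℕ)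
open import Data.Fin.Properties using (toℕ-fromℕ<; toℕ-injective; toℕ<n)
open import Data.Nat.Tactic.RingSolver using (solve-∀)
open import Function using (_∘_)
open import Relation.Binary.PropositionalEquality

infixl 10 ∑<
∑< : ℕ → (ℕ → ℕ) → ℕ
∑< zero    f = 0
∑< (suc n) f = f 0 + ∑< n (f ∘ suc)

syntax ∑< n (λ k → e) = ∑[ k < n ] e

∑-cong : ∀ n {f g : ℕ → ℕ} → (∀ k → f k ≡ g k) → ∑< n f ≡ ∑< n g
∑-cong zero    f≗g = refl
∑-cong (suc n) f≗g = cong₂ _+_ (f≗g 0) (∑-cong n (f≗g ∘ suc))

∑-distrib-+ : ∀ n f g → ∑[ k < n ] (f k + g k) ≡ ∑< n f + ∑< n g
∑-distrib-+ zero    f g = refl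
∑-distrib-+ (suc n) f g = begin
  (f 0 + g 0) + ∑[ k < n ] (f (suc k) + g (suc k))
    ≡⟨ cong (f 0 + g 0 +_) (∑-distrib-+ n (f ∘ suc) (g ∘ suc)) ⟩
  (f 0 + g 0) + (∑< n (f ∘ suc) + ∑< n (g ∘ suc))
    ≡⟨ swap-middle (f 0) (g 0) _ _ ⟩
  (f 0 + ∑< n (f ∘ suc)) + (g 0 + ∑< n (g ∘ suc))
    ∎
  where
  open ≡-Reasoning
  swap-middle : ∀ a b c d → (a + b) + (c + d) ≡ (a + c) + (b + d)
  swap-middle = solve-∀

∑-init-last : ∀ n f → ∑< (suc n) f ≡ ∑< n f + f n
∑-init-last zero    f = +-comm (f 0) 0
∑-init-last (suc n) f = trans (cong (f 0 +_) (∑-init-last n (f ∘ suc)))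
                              (sym (+-assoc (f 0) _ _))

∣-∑ : ∀ {d} n f → (∀ k → k < n → d ∣ f k) → d ∣ ∑< n f
∣-∑ {d} zero    f d∣f = d ∣0
∣-∑     (suc n) f d∣f =
  ∣m∣n⇒∣m+n (d∣f 0 (s≤s z≤n)) (∣-∑ n (f ∘ suc) (λ k k<n → d∣f (suc k) (s≤s k<n)))

-- binomialSum n g = ((1 + X)ⁿ g) 0 for the shift X g = g ∘ suc.
binomialSum : ℕ → (ℕ → ℕ) → ℕ
binomialSum n g = ∑[ k < suc n ] ((n C k) * g k)

binomialSum-cong : ∀ n {g h : ℕ → ℕ} → (∀ k → g k ≡ h k) → binomialSum n g ≡ binomialSum n h
binomialSum-cong n g≗h = ∑-cong (suc n) (λ k → cong ((n C k) *_) (g≗h k))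

binomialSum-distrib-+ : ∀ n g h →
                        binomialSum n (λ k → g k + h k) ≡ binomialSum n g + binomialSum n h
binomialSum-distrib-+ n g h =
  trans (∑-cong (suc n) (λ k → *-distribˡ-+ (n C k) (g k) (h k)))
        (∑-distrib-+ (suc n) (λ k → (n C k) * g k) (λ k → (n C k) * h k))

binomialSum-head-tail : ∀ n g → binomialSum n g ≡ g 0 + ∑[ k < suc n ] ((n C suc k) * g (suc k))
binomialSum-head-tail n g = begin
  1 * g 0 + ∑< n term
    ≡⟨ cong₂ _+_ (*-identityˡ (g 0)) (sym (+-identityʳ _)) ⟩
  g 0 + (∑< n term + 0)
    ≡⟨ cong (λ c → g 0 + (∑< n term + c * g (suc n))) (sym (k>n⇒nCk≡0 (n<1+n n))) ⟩
  g 0 + (∑< n term + term n)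
    ≡⟨ cong (g 0 +_) (sym (∑-init-last n term)) ⟩
  g 0 + ∑< (suc n) term
    ∎
  where
  open ≡-Reasoning
  term : ℕ → ℕ
  term k = (n C suc k) * g (suc k)

binomialSum-suc : ∀ n g → binomialSum (suc n) g ≡ binomialSum n g + binomialSum n (g ∘ suc)
binomialSum-suc n g = begin
  1 * g 0 + ∑[ k < suc n ] ((suc n C suc k) * g (suc k))
    ≡⟨ cong₂ _+_ (*-identityˡ (g 0)) (∑-cong (suc n) pascal) ⟩
  g 0 + ∑[ k < suc n ] ((n C k) * g (suc k) + (n C suc k) * g (suc k))
    ≡⟨ cong (g 0 +_) (∑-distrib-+ (suc n) (λ k → (n C k) * g (suc k))
                                          (λ k → (n C suc k) * g (suc k))) ⟩
  g 0 + (binomialSum n (g ∘ suc) + tail)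
    ≡⟨ rotate (g 0) _ tail ⟩
  (g 0 + tail) + binomialSum n (g ∘ suc)
    ≡⟨ cong (_+ binomialSum n (g ∘ suc)) (sym (binomialSum-head-tail n g)) ⟩
  binomialSum n g + binomialSum n (g ∘ suc)
    ∎
  where
  open ≡-Reasoning
  tail : ℕ
  tail = ∑[ k < suc n ] ((n C suc k) * g (suc k))
  pascal : ∀ k → (suc n C suc k) * g (suc k) ≡ (n C k) * g (suc k) + (n C suc k) * g (suc k)
  pascal k = trans (cong (_* g (suc k)) (sym (nCk+nC[k+1]≡[n+1]C[k+1] n k)))
                   (*-distribʳ-+ (g (suc k)) (n C k) (n C suc k))
  rotate : ∀ a b c → a + (b + c) ≡ (a + c) + b
  rotate = solve-∀

binomialSum-ends : ∀ n .{{_ : NonZero n}} g →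
                   binomialSum n g ≡ (g 0 + g n) + ∑[ k < pred n ] ((n C suc k) * g (suc k))
binomialSum-ends (suc m) g = begin
  1 * g 0 + ∑[ k < suc m ] ((suc m C suc k) * g (suc k))
    ≡⟨ cong (1 * g 0 +_) (∑-init-last m (λ k → (suc m C suc k) * g (suc k))) ⟩
  1 * g 0 + (inner + (suc m C suc m) * g (suc m))
    ≡⟨ cong (λ c → 1 * g 0 + (inner + c * g (suc m))) (nCn≡1 (suc m)) ⟩
  1 * g 0 + (inner + 1 * g (suc m))
    ≡⟨ rearrange (g 0) inner (g (suc m)) ⟩
  (g 0 + g (suc m)) + inner
    ∎
  where
  open ≡-Reasoning
  inner : ℕ
  inner = ∑[ k < m ] ((suc m C suc k) * g (suc k))
  rearrange : ∀ a b c → 1 * a + (b + 1 * c) ≡ (a + c) + b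
  rearrange = solve-∀

binomialSum₂ : ℕ → (ℕ → ℕ → ℕ) → ℕ
binomialSum₂ n F = binomialSum n (λ k → binomialSum n (F k))

-- Window sums over S(2) = {0,1}² and over S(2)^*; s2Sum F = (1 + X)(1 + Y) F.
s2Sum : (ℕ → ℕ → ℕ) → ℕ → ℕ → ℕ
s2Sum F k l = (F k l + F k (suc l)) + (F (suc k) l + F (suc k) (suc l))

binomialSum₂-suc : ∀ n F → binomialSum₂ (suc n) F ≡ binomialSum₂ n (s2Sum F)
binomialSum₂-suc n F = begin
  binomialSum (suc n) row
    ≡⟨ binomialSum-suc n row ⟩
  binomialSum n row + binomialSum n (row ∘ suc)
    ≡⟨ sym (binomialSum-distrib-+ n row (row ∘ suc)) ⟩
  binomialSum n (λ k → row k + row (suc k))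
    ≡⟨ binomialSum-cong n (λ k → trans (cong₂ _+_ (row-suc k) (row-suc (suc k))) (merge k)) ⟩
  binomialSum₂ n (s2Sum F)
    ∎
  where
  open ≡-Reasoning
  row : ℕ → ℕ
  row k = binomialSum (suc n) (F k)
  rowPair : ℕ → ℕ → ℕ
  rowPair k l = F k l + F k (suc l)
  row-suc : ∀ k → row k ≡ binomialSum n (rowPair k)
  row-suc k = trans (binomialSum-suc n (F k)) (sym (binomialSum-distrib-+ n (F k) (F k ∘ suc)))
  merge : ∀ k → binomialSum n (rowPair k) + binomialSum n (rowPair (suc k)) ≡ binomialSum n (s2Sum F k)
  merge k = sym (binomialSum-distrib-+ n (rowPair k) (rowPair (suc k)))

s2*Sum : (ℕ → ℕ → ℕ) → ℕ → ℕ → ℕ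
s2*Sum F k l = (F (suc k) l + F k (suc l)) + F (suc k) (suc l)

s2Sum≡+s2*Sum : ∀ F k l → s2Sum F k l ≡ F k l + s2*Sum F k l
s2Sum≡+s2*Sum F k l = rearrange (F k l) (F k (suc l)) (F (suc k) l) (F (suc k) (suc l))
  where
  rearrange : ∀ a b c d → (a + b) + (c + d) ≡ a + ((c + b) + d)
  rearrange = solve-∀

DoublyPeriodic : ℕ → (ℕ → ℕ → ℕ) → Set
DoublyPeriodic p F = (∀ k l → F (k + p) l ≡ F k l) × (∀ k l → F k (l + p) ≡ F k l)

shift : ℕ → ℕ → (ℕ → ℕ → ℕ) → ℕ → ℕ → ℕ
shift i j F k l = F (i + k) (j + l)

shift-doublyPeriodic : ∀ {p F} i j → DoublyPeriodic p F → DoublyPeriodic p (shift i j F)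
shift-doublyPeriodic {p} {F} i j (periodicˡ , periodicʳ) =
  (λ k l → trans (cong (λ a → F a (j + l)) (sym (+-assoc i k p))) (periodicˡ (i + k) (j + l))) ,
  (λ k l → trans (cong (F (i + k)) (sym (+-assoc j l p))) (periodicʳ (i + k) (j + l)))

s2*Sum-shift : ∀ i j F k l → s2*Sum (shift i j F) k l ≡ s2*Sum F (i + k) (j + l)
s2*Sum-shift i j F k l =
  cong₂ (λ a b → (F a (j + l) + F (i + k) b) + F a b) (+-suc i k) (+-suc j l)

module Modulo (n : ℕ) .{{_ : NonZero n}} where

  infix 4 _≈_
  _≈_ : ℕ → ℕ → Set
  x ≈ y = x % n ≡ y % n

  +-cong-≈ : ∀ {x y u v} → x ≈ y → u ≈ v → x + u ≈ y + v
  +-cong-≈ {x} {y} {u} {v} x≈y u≈v = begin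
    (x + u) % n             ≡⟨ %-distribˡ-+ x u n ⟩
    (x % n + u % n) % n     ≡⟨ cong₂ (λ a b → (a + b) % n) x≈y u≈v ⟩
    (y % n + v % n) % n     ≡⟨ %-distribˡ-+ y v n ⟨
    (y + v) % n             ∎
    where open ≡-Reasoning

  *-congˡ-≈ : ∀ c {x y} → x ≈ y → c * x ≈ c * y
  *-congˡ-≈ c {x} {y} x≈y = begin
    (c * x) % n             ≡⟨ %-distribˡ-* c x n ⟩
    (c % n * (x % n)) % n   ≡⟨ cong (λ a → (c % n * a) % n) x≈y ⟩
    (c % n * (y % n)) % n   ≡⟨ %-distribˡ-* c y n ⟨
    (c * y) % n             ∎
    where open ≡-Reasoning

  ∑-cong-≈ : ∀ m {f g : ℕ → ℕ} → (∀ k → f k ≈ g k) → ∑< m f ≈ ∑< m g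
  ∑-cong-≈ zero    f≈g = refl
  ∑-cong-≈ (suc m) f≈g = +-cong-≈ (f≈g 0) (∑-cong-≈ m (f≈g ∘ suc))

  binomialSum-cong-≈ : ∀ m {g h : ℕ → ℕ} → (∀ k → g k ≈ h k) → binomialSum m g ≈ binomialSum m h
  binomialSum-cong-≈ m g≈h = ∑-cong-≈ (suc m) (λ k → *-congˡ-≈ (m C k) (g≈h k))

  binomialSum₂-cong-≈ : ∀ m {F G : ℕ → ℕ → ℕ} → (∀ k l → F k l ≈ G k l) →
                        binomialSum₂ m F ≈ binomialSum₂ m G
  binomialSum₂-cong-≈ m F≈G = binomialSum-cong-≈ m (λ k → binomialSum-cong-≈ m (F≈G k))

  binomialSum₂-fixed : ∀ {F} → (∀ k l → s2Sum F k l ≈ F k l) → ∀ m → binomialSum₂ m F ≈ F 0 0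
  binomialSum₂-fixed {F} fixed zero    = cong (_% n) binomialSum₂-zero
    where
    binomialSum₂-zero : binomialSum₂ 0 F ≡ F 0 0
    binomialSum₂-zero = trans (+-identityʳ _) (trans (*-identityˡ _)
                          (trans (+-identityʳ _) (*-identityˡ _)))
  binomialSum₂-fixed {F} fixed (suc m) = begin
    binomialSum₂ (suc m) F % n    ≡⟨ cong (_% n) (binomialSum₂-suc m F) ⟩
    binomialSum₂ m (s2Sum F) % n  ≡⟨ binomialSum₂-cong-≈ m fixed ⟩
    binomialSum₂ m F % n          ≡⟨ binomialSum₂-fixed fixed m ⟩
    F 0 0 % n                     ∎
    where open ≡-Reasoning

  ∣s2*Sum⇒s2Sum≈ : ∀ F k l → n ∣ s2*Sum F k l → s2Sum F k l ≈ F k l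
  ∣s2*Sum⇒s2Sum≈ F k l n∣s = trans (cong (_% n) (s2Sum≡+s2*Sum F k l)) (%-remove-+ʳ (F k l) n∣s)

  a+b≈a⇒n∣b : ∀ a b → a + b ≈ a → n ∣ b
  a+b≈a⇒n∣b a b a+b≈a = m%n≡0⇒n∣m b n (begin
    b % n                      ≡⟨ %-remove-+ʳ b (m∣m*n a) ⟨
    (b + n * a) % n            ≡⟨ cong (λ c → (b + c * a) % n) (suc-pred n) ⟨
    (b + (a + pred n * a)) % n ≡⟨ cong (_% n) (+-reassoc b a (pred n * a)) ⟩
    ((a + b) + pred n * a) % n ≡⟨ +-cong-≈ a+b≈a refl ⟩
    (a + pred n * a) % n       ≡⟨ cong (λ c → (c * a) % n) (suc-pred n) ⟩
    (n * a) % n                ≡⟨ n∣m⇒m%n≡0 (n * a) n (m∣m*n a) ⟩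
    0                          ∎)
    where
    open ≡-Reasoning
    +-reassoc : ∀ x y z → x + (y + z) ≡ (y + x) + z
    +-reassoc = solve-∀

n∣n! : ∀ n .{{_ : NonZero n}} → n ∣ n !
n∣n! (suc m) = m∣m*n (m !)

module ModuloPrime (p : ℕ) .{{_ : NonZero p}} (p-prime : Prime p) where

  open Modulo p

  p∤k! : ∀ {k} → k < p → ¬ p ∣ k !
  p∤k! {zero}  _   p∣1 = nonTrivial⇒≢1 {{prime⇒nonTrivial p-prime}} (∣1⇒≡1 p∣1)
  p∤k! {suc k} k<p p∣k! with euclidsLemma (suc k) (k !) p-prime p∣k!
  ... | inj₁ p∣1+k = <⇒≱ k<p (∣⇒≤ p∣1+k)
  ... | inj₂ p∣k!  = p∤k! (<-trans (n<1+n k) k<p) p∣k!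

  p∣pCk : ∀ {k} → 0 < k → k < p → p ∣ p C k
  p∣pCk {k} 0<k k<p with euclidsLemma (p C k) (k ! * (p ∸ k) !) p-prime p∣pCk*k![p∸k]!
    where
    instance _ = k !* (p ∸ k) !≢0
    p∣pCk*k![p∸k]! : p ∣ (p C k) * (k ! * (p ∸ k) !)
    p∣pCk*k![p∸k]! = subst (p ∣_)
      (sym (trans (cong (_* (k ! * (p ∸ k) !)) (nCk≡n!/k![n-k]! (<⇒≤ k<p)))
                  (m/n*n≡m (k![n∸k]!∣n! (<⇒≤ k<p)))))
      (n∣n! p)
  ... | inj₁ p∣pCk = p∣pCk
  ... | inj₂ p∣k![p∸k]! with euclidsLemma (k !) ((p ∸ k) !) p-prime p∣k![p∸k]!
  ...   | inj₁ p∣k!     = contradiction p∣k! (p∤k! k<p)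
  ...   | inj₂ p∣[p∸k]! = contradiction p∣[p∸k]! (p∤k! (∸-monoʳ-< 0<k (<⇒≤ k<p)))

  binomialSum-frobenius : ∀ g → binomialSum p g ≈ g 0 + g p
  binomialSum-frobenius g =
    trans (cong (_% p) (binomialSum-ends p g))
          (%-remove-+ʳ (g 0 + g p) (∣-∑ (pred p) (λ k → (p C suc k) * g (suc k)) p∣term))
    where
    p∣term : ∀ k → k < pred p → p ∣ (p C suc k) * g (suc k)
    p∣term k k<p-1 =
      ∣m⇒∣m*n (g (suc k)) (p∣pCk (s≤s z≤n) (subst (suc k <_) (suc-pred p) (s≤s k<p-1)))

  binomialSum₂-frobenius : ∀ F → binomialSum₂ p F ≈ (F 0 0 + F 0 p) + (F p 0 + F p p)
  binomialSum₂-frobenius F =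
    trans (binomialSum-cong-≈ p (λ k → binomialSum-frobenius (F k)))
          (binomialSum-frobenius (λ k → F k 0 + F k p))

  p∣3*x⇒p∣x : 3 < p → ∀ {x} → p ∣ 3 * x → p ∣ x
  p∣3*x⇒p∣x 3<p {x} p∣3x with euclidsLemma 3 x p-prime p∣3x
  ... | inj₁ p∣3 = contradiction (∣⇒≤ p∣3) (<⇒≱ 3<p)
  ... | inj₂ p∣x = p∣x

  doublyPeriodic∧fixed⇒p∣origin : 3 < p → ∀ {F} → DoublyPeriodic p F →
                                 (∀ k l → s2Sum F k l ≈ F k l) → p ∣ F 0 0
  doublyPeriodic∧fixed⇒p∣origin 3<p {F} (periodicˡ , periodicʳ) fixed =
    p∣3*x⇒p∣x 3<p (a+b≈a⇒n∣b x (3 * x) x+3x≈x)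
    where
    open ≡-Reasoning
    x : ℕ
    x = F 0 0
    corners : (F 0 0 + F 0 p) + (F p 0 + F p p) ≡ (x + x) + (x + x)
    corners = cong₂ _+_ (cong (x +_) (periodicʳ 0 0))
                        (cong₂ _+_ (periodicˡ 0 0) (trans (periodicˡ 0 p) (periodicʳ 0 0)))
    four : ∀ y → (y + y) + (y + y) ≡ y + 3 * y
    four = solve-∀
    x+3x≈x : x + 3 * x ≈ x
    x+3x≈x = begin
      (x + 3 * x) % p                          ≡⟨ cong (_% p) (trans corners (four x)) ⟨
      ((F 0 0 + F 0 p) + (F p 0 + F p p)) % p  ≡⟨ binomialSum₂-frobenius F ⟨
      binomialSum₂ p F % p                     ≡⟨ binomialSum₂-fixed fixed p ⟩
      x % p                                    ∎

  doublyPeriodic∧p∣s2*Sum⇒p∣ : 3 < p → ∀ {F} → DoublyPeriodic p F →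
                               (∀ k l → p ∣ s2*Sum F k l) → ∀ i j → p ∣ F i j
  doublyPeriodic∧p∣s2*Sum⇒p∣ 3<p {F} periodic p∣s2*Sum i j =
    subst (p ∣_) (cong₂ F (+-identityʳ i) (+-identityʳ j))
      (doublyPeriodic∧fixed⇒p∣origin 3<p (shift-doublyPeriodic i j periodic) fixed)
    where
    fixed : ∀ k l → s2Sum (shift i j F) k l ≈ shift i j F k l
    fixed k l = ∣s2*Sum⇒s2Sum≈ (shift i j F) k l
                  (subst (p ∣_) (sym (s2*Sum-shift i j F k l)) (p∣s2*Sum (i + k) (j + l)))

module Representatives (p : ℕ) .{{_ : NonZero p}} where

  open Modulo p

  toℕ-mod : ∀ x → toℕ (x mod p) ≡ x % p
  toℕ-mod x = toℕ-fromℕ< (m%n<n x p)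

  toℕ-mod-toℕ : ∀ u → toℕ u mod p ≡ u
  toℕ-mod-toℕ u = toℕ-injective (trans (toℕ-mod (toℕ u)) (m<n⇒m%n≡m (toℕ<n u)))

  mod-cong : ∀ {x y} → x ≈ y → x mod p ≡ y mod p
  mod-cong {x} {y} x≈y = toℕ-injective (trans (toℕ-mod x) (trans x≈y (sym (toℕ-mod y))))

  p∣⇒≈0 : ∀ {x} → p ∣ x → x ≈ 0
  p∣⇒≈0 {x} p∣x = trans (n∣m⇒m%n≡0 x p p∣x) (sym (n∣m⇒m%n≡0 0 p (p ∣0)))

  mod-⊕-mod : ∀ x y → _⊕_ p (x mod p) (y mod p) ≡ (x + y) mod p
  mod-⊕-mod x y = mod-cong (begin
    (toℕ (x mod p) + toℕ (y mod p)) % p  ≡⟨ cong₂ (λ a b → (a + b) % p) (toℕ-mod x) (toℕ-mod y) ⟩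
    (x % p + y % p) % p                  ≡⟨ +-cong-≈ (m%n%n≡m%n x p) (m%n%n≡m%n y p) ⟩
    (x + y) % p                          ∎)
    where open ≡-Reasoning

  mod-⊕-one : ∀ x → _⊕_ p (x mod p) (one p) ≡ suc x mod p
  mod-⊕-one x = trans (mod-⊕-mod x 1) (cong (_mod p) (+-comm x 1))

  lift : Array p → ℕ → ℕ → ℕ
  lift a i j = toℕ (a (i mod p) (j mod p))

  lift-toℕ : ∀ a u v → lift a (toℕ u) (toℕ v) ≡ toℕ (a u v)
  lift-toℕ a u v = cong₂ (λ x y → toℕ (a x y)) (toℕ-mod-toℕ u) (toℕ-mod-toℕ v)

  lift-doublyPeriodic : ∀ a → DoublyPeriodic p (lift a)
  lift-doublyPeriodic a =
    (λ i j → cong (λ x → toℕ (a x (j mod p))) (mod-cong ([m+n]%n≡m%n i p))) ,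
    (λ i j → cong (λ y → toℕ (a (i mod p) y)) (mod-cong ([m+n]%n≡m%n j p)))

  lift-s2*Sum : ∀ a → InS2* p a → ∀ i j → p ∣ s2*Sum (lift a) i j
  lift-s2*Sum a a∈S2* i j = m%n≡0⇒n∣m (s2*Sum (lift a) i j) p (begin
    ((x + y) + z) % p                                ≡⟨ +-cong-≈ (sym (m%n%n≡m%n (x + y) p)) refl ⟩
    ((x + y) % p + z) % p                            ≡⟨ cong (λ w → (w + z) % p) (toℕ-mod (x + y)) ⟨
    (toℕ ((x + y) mod p) + z) % p                    ≡⟨ toℕ-mod _ ⟨
    toℕ (_⊕_ p (_⊕_ p (a i′ (j mod p)) (a (i mod p) j′)) (a i′ j′))
                                                     ≡⟨ cong toℕ relation ⟩
    toℕ (0 mod p)                                    ≡⟨ toℕ-mod 0 ⟩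
    0 % p                                            ≡⟨ n∣m⇒m%n≡0 0 p (p ∣0) ⟩
    0                                                ∎)
    where
    open ≡-Reasoning
    i′ = suc i mod p
    j′ = suc j mod p
    x = lift a (suc i) j
    y = lift a i (suc j)
    z = lift a (suc i) (suc j)
    relation : _⊕_ p (_⊕_ p (a i′ (j mod p)) (a (i mod p) j′)) (a i′ j′) ≡ 0 mod p
    relation = subst₂ (λ u v → _⊕_ p (_⊕_ p (a u (j mod p)) (a (i mod p) v)) (a u v) ≡ 0 mod p)
                      (mod-⊕-one i) (mod-⊕-one j) (a∈S2* (i mod p) (j mod p))

proposition4p1 : (p : ℕ) .{{_ : NonZero p}} → Prime p → 3 < p →
                   (a : Array p) → InS2* p a → IsZero p a
proposition4p1 p p-prime 3<p a a∈S2* u v = begin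
  a u v              ≡⟨ toℕ-mod-toℕ (a u v) ⟨
  toℕ (a u v) mod p  ≡⟨ mod-cong (p∣⇒≈0 p∣a[u,v]) ⟩
  0 mod p            ∎
  where
  open ≡-Reasoning
  open Representatives p
  open ModuloPrime p p-prime using (doublyPeriodic∧p∣s2*Sum⇒p∣)
  p∣a[u,v] : p ∣ toℕ (a u v)
  p∣a[u,v] = subst (p ∣_) (lift-toℕ a u v)
    (doublyPeriodic∧p∣s2*Sum⇒p∣ 3<p (lift-doublyPeriodic a) (lift-s2*Sum a a∈S2*) (toℕ u) (toℕ v))
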